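{- Let $(\mathcal{U},\mathcal{C},k)$ be a Set Cover instance with $\mathcal{U}=\{e_1,\dots,e_n\}$, $\mathcal{C}=\{C_1,\dots,C_m\}$, $C_j\subseteq\mathcal{U}$, and integer $k>1$, and let $I'$ be the $\textsc{MinSumC}$ instance constructed from it as in the context, with $k'=(k+1)n$. If $M$ is an $\mathcal{A}$-perfect envy-free matching in $I'$ with $c(M)\le\alpha k'$ for some constant $\alpha>1$, then one can construct from $M$ a set cover $T\subseteq\mathcal{C}$ (i.e. $\bigcup_{C\in T}C=\mathcal{U}$) with $|T|\le 2\alpha k$.
   Context: $\textsc{MinSumC}$ instance: agents $\mathcal{A}$, programs $\mathcal{P}$, acceptable pairs $E$, strict preference orders of each agent over its acceptable programs and of each program over its acceptable agents, and a non-negative integer cost $c(p)$ per program (no capacity limits). A matching $M\subseteq E$ has each agent in at most one pair; $M(a)$ is $a$'s partner or $\bot$, with every acceptable program preferred to $\bot$. $M$ is envy-free if there are no $(a,p)\in M$ and agent $a'$ acceptable to $p$ with $a'\succ_p a$ and $p\succ_{a'}M(a')$; $\mathcal{A}$-perfect if all agents are matched; $c(M)=\sum_{(a,p)\in M}c(p)$. Construction of $I'$: for each element $e_i$ an element-agent $a_i$; for each set $C_j$ a subset-program $c_j$ with cost $1$, and $n$ dummy agents $u_j^1,\dots,u_j^n$ and $n$ dummy programs $w_j^1,\dots,w_j^n$ with cost $0$. Preferences: $a_i$ ranks exactly the programs $\{c_j: e_i\in C_j\}$ in a fixed arbitrary order; $u_j^l: c_j\succ w_j^l$; $c_j$ ranks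 all of $u_j^1,\dots,u_j^n$ (fixed arbitrary order) above all agents in $\{a_i: e_i\in C_j\}$ (fixed arbitrary order); $w_j^l$ ranks only $u_j^l$.
   Formalization: The constant α > 1 ranges over the rationals. -}

module Defs where

open import Data.Nat using (ℕ; zero; suc; _+_; _*_; _<_; _≤_)
open import Data.Fin using (Fin)
open import Data.Fin.Subset using (Subset; _∈_)
open import Data.Maybe using (Maybe; just; nothing; maybe)
open import Data.Sum using (_⊎_; inj₁; inj₂)
open import Data.Product using (Σ; ∃; _×_; _,_)
open import Data.List using (List; map; _++_; allFin; cartesianProductWith)
open import Data.Nat.ListAction using (sum)
open import Data.Unit using (⊤)
open import Data.Empty using (⊥)
open import Relation.Nullary using (¬_)
open import Relation.Binary.PropositionalEquality using (_≡_)

record MinSumC : Set₁ where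
  field
    Agent   : Set
    Program : Set
    -- the finite set of agents, enumerated (each agent exactly once)
    agents  : List Agent
    Acc     : Agent → Program → Set
    -- PrefA a p q : agent a strictly prefers program p to program q
    PrefA   : Agent → Program → Program → Set
    -- PrefP p a b : program p strictly prefers agent a to agent b
    PrefP   : Program → Agent → Agent → Set
    cost    : Program → ℕ

module _ (I : MinSumC) where
  open MinSumC I

  record Matching : Set where
    field
      M     : Agent → Maybe Program
      M-acc : ∀ a p → M a ≡ just p → Acc a p

  PrefersTo : Agent → Program → Maybe Program → Set
  PrefersTo a p nothing  = ⊤
  PrefersTo a p (just q) = PrefA a p q

  EnvyFree : Matching → Set
  EnvyFree μ = ∀ a p a' → Matching.M μ a ≡ just p → Acc a' p →
               PrefP p a' a → ¬ PrefersTo a' p (Matching.M μ a')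

  APerfect : Matching → Set
  APerfect μ = ∀ a → ∃ λ p → Matching.M μ a ≡ just p

  costOf : Matching → ℕ
  costOf μ = sum (map (λ a → maybe cost 0 (Matching.M μ a)) agents)

IsCover : ∀ {n m} → (Fin m → Subset n) → Subset m → Set
IsCover {n} C T = ∀ (i : Fin n) → ∃ λ j → (j ∈ T) × (i ∈ C j)

-- Agents : inj₁ i = a_i ;  inj₂ (j , l) = u_j^l
-- Programs: inj₁ j = c_j ;  inj₂ (j , l) = w_j^l
-- The "fixed arbitrary orders" are given by rank functions (smaller = better):
--   ordA i  : a_i's order on programs c_j
--   ordU j  : c_j's order on u_j^1..u_j^n
--   ordE j  : c_j's order on element agents a_i

CAgent : ℕ → ℕ → Set
CAgent n m = Fin n ⊎ (Fin m × Fin n)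

CProgram : ℕ → ℕ → Set
CProgram n m = Fin m ⊎ (Fin m × Fin n)

module Construction {n m : ℕ} (C : Fin m → Subset n)
  (ordA : Fin n → Fin m → ℕ) (ordU ordE : Fin m → Fin n → ℕ) where

  acc : CAgent n m → CProgram n m → Set
  acc (inj₁ i)       (inj₁ j)        = i ∈ C j
  acc (inj₁ i)       (inj₂ _)        = ⊥
  acc (inj₂ (j , l)) (inj₁ j')       = j ≡ j'
  acc (inj₂ (j , l)) (inj₂ (j' , l')) = (j ≡ j') × (l ≡ l')

  prefA : CAgent n m → CProgram n m → CProgram n m → Set
  prefA (inj₁ i) (inj₁ j) (inj₁ j') = ordA i j < ordA i j'
  prefA (inj₁ i) _        _         = ⊥
  prefA (inj₂ _) (inj₁ _) (inj₂ _)  = ⊤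
  prefA (inj₂ _) _        _         = ⊥

  prefP : CProgram n m → CAgent n m → CAgent n m → Set
  prefP (inj₁ j) (inj₂ (_ , l)) (inj₂ (_ , l')) = ordU j l < ordU j l'
  prefP (inj₁ j) (inj₂ _)       (inj₁ _)        = ⊤
  prefP (inj₁ j) (inj₁ _)       (inj₂ _)        = ⊥
  prefP (inj₁ j) (inj₁ i)       (inj₁ i')       = ordE j i < ordE j i'
  prefP (inj₂ _) _              _               = ⊥

  costP : CProgram n m → ℕ
  costP (inj₁ _) = 1
  costP (inj₂ _) = 0

  agentList : List (CAgent n m)
  agentList = map inj₁ (allFin n) ++
              map inj₂ (cartesianProductWith _,_ (allFin m) (allFin n))

  I' : MinSumC
  I' = record
    { Agent = CAgent n m ; Program = CProgram n m ; agents = agentList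
    ; Acc = acc ; PrefA = prefA ; PrefP = prefP ; cost = costP }

{-# OPTIONS --safe #-}
module Submission where

-- Let T be the set of subset-programs c_j to which some element-agent is matched; it covers
-- the universe because every element-agent is matched to a set containing its element.
-- For j ∈ T, every dummy agent u_j^l must sit at c_j as well: otherwise it sits at w_j^l and
-- envies the element-agent at c_j, which c_j ranks below all dummies. Each such dummy pays 1,
-- so |T| n ≤ c(M) ≤ α (k + 1) n, whence |T| ≤ α (k + 1) ≤ 2 α k. The constant α = p / q is
-- encoded by the two naturals p and q.

open import Defs
open import Data.Nat using (ℕ; zero; suc; _+_; _*_; _<_; _≤_; z≤n)
open import Data.Nat.Properties
  using (≤-refl; ≤-reflexive; ≤-trans; <⇒≤; m≤m+n; m≤n+m; +-mono-≤; +-monoʳ-≤; *-monoˡ-≤; *-monoʳ-≤;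
         *-assoc; *-cancelʳ-≤; *-commutativeSemigroup; module ≤-Reasoning)
open import Algebra.Properties.CommutativeSemigroup *-commutativeSemigroup using (x∙yz≈yx∙z; xy∙z≈xz∙y)
open import Data.Nat.ListAction using (sum)
open import Data.Nat.ListAction.Properties using (sum-++)
open import Data.Fin using (Fin; zero; suc; _≟_)
open import Data.Fin.Properties using (any?; nonZeroIndex)
open import Data.Fin.Subset using (Subset; _∈_; ∣_∣)
open import Data.Fin.Subset.Properties using (nonempty?; Empty-unique; ∣⊥∣≡0)
open import Data.Vec as Vec using (here; there)
open import Data.Vec.Properties using (lookup∘tabulate; lookup⇒[]=; []=⇒lookup)
open import Data.Bool using (true; false)
open import Data.Maybe using (just; maybe)
open import Data.Sum using (inj₁; inj₂)
open import Data.Product using (Σ; ∃; _×_; _,_; proj₁; proj₂)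
open import Data.List using (List; []; _∷_; map; _++_; allFin; tabulate; cartesianProductWith)
open import Data.List.Properties using (map-++; map-∘; map-tabulate)
open import Data.Empty using (⊥-elim)
open import Data.Unit using (tt)
open import Function using (_∘_; id)
open import Function.Definitions using (Injective)
open import Relation.Nullary using (yes; no; does)
open import Relation.Nullary.Decidable using (dec-true)
open import Relation.Unary using (Pred; Decidable)
open import Relation.Binary.PropositionalEquality

sum-cartesianProduct : ∀ {A B : Set} (h : A × B → ℕ) (xs : List A) (ys : List B) →
  sum (map h (cartesianProductWith _,_ xs ys)) ≡ sum (map (λ x → sum (map (λ y → h (x , y)) ys)) xs)
sum-cartesianProduct h []       ys = refl
sum-cartesianProduct h (x ∷ xs) ys = begin
  sum (map h (map (x ,_) ys ++ cartesianProductWith _,_ xs ys))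
    ≡⟨ cong sum (map-++ h (map (x ,_) ys) _) ⟩
  sum (map h (map (x ,_) ys) ++ map h (cartesianProductWith _,_ xs ys))
    ≡⟨ sum-++ (map h (map (x ,_) ys)) _ ⟩
  sum (map h (map (x ,_) ys)) + sum (map h (cartesianProductWith _,_ xs ys))
    ≡⟨ cong₂ _+_ (cong sum (map-∘ ys)) (sym (sum-cartesianProduct h xs ys)) ⟨
  sum (map (λ y → h (x , y)) ys) + sum (map (λ x → sum (map (λ y → h (x , y)) ys)) xs)
    ∎
  where open ≡-Reasoning

n≤sum-tabulate : ∀ {n} (F : Fin n → ℕ) → (∀ i → 1 ≤ F i) → n ≤ sum (tabulate F)
n≤sum-tabulate {zero}  F 1≤F = z≤n
n≤sum-tabulate {suc n} F 1≤F = +-mono-≤ (1≤F zero) (n≤sum-tabulate (F ∘ suc) (1≤F ∘ suc))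

∣p∣*b≤sum-tabulate : ∀ {m b} (p : Subset m) (F : Fin m → ℕ) →
  (∀ {j} → j ∈ p → b ≤ F j) → ∣ p ∣ * b ≤ sum (tabulate F)
∣p∣*b≤sum-tabulate Vec.[]          F b≤F = z≤n
∣p∣*b≤sum-tabulate (true Vec.∷ p)  F b≤F =
  +-mono-≤ (b≤F here) (∣p∣*b≤sum-tabulate p (F ∘ suc) (b≤F ∘ there))
∣p∣*b≤sum-tabulate (false Vec.∷ p) F b≤F =
  ≤-trans (∣p∣*b≤sum-tabulate p (F ∘ suc) (b≤F ∘ there)) (m≤n+m _ (F zero))

subset : ∀ {m ℓ} {P : Pred (Fin m) ℓ} → Decidable P → Subset m
subset P? = Vec.tabulate (does ∘ P?)

module _ {m ℓ} {P : Pred (Fin m) ℓ} (P? : Decidable P) where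

  ∈subset⁺ : ∀ {j} → P j → j ∈ subset P?
  ∈subset⁺ {j} Pj = lookup⇒[]= j _ (trans (lookup∘tabulate _ j) (dec-true (P? j) Pj))

  ∈subset⁻ : ∀ {j} → j ∈ subset P? → P j
  ∈subset⁻ {j} j∈ with P? j | trans (sym (lookup∘tabulate (does ∘ P?) j)) ([]=⇒lookup j∈)
  ... | yes Pj | _ = Pj
  ... | no _   | ()

p*[k+1]≤2*p*k : ∀ p {k} → 1 ≤ k → p * (k + 1) ≤ 2 * p * k
p*[k+1]≤2*p*k p {k} 1≤k = begin
  p * (k + 1)     ≤⟨ *-monoʳ-≤ p (+-monoʳ-≤ k (≤-trans 1≤k (m≤m+n k 0))) ⟩
  p * (2 * k)     ≡⟨ x∙yz≈yx∙z p 2 k ⟩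
  2 * p * k       ∎
  where open ≤-Reasoning

module CoverFromMatching {n m : ℕ} (C : Fin m → Subset n)
    (ordA : Fin n → Fin m → ℕ) (ordU ordE : Fin m → Fin n → ℕ)
    (μ : Matching (Construction.I' C ordA ordU ordE))
    (perfect : APerfect (Construction.I' C ordA ordU ordE) μ)
    (envy-free : EnvyFree (Construction.I' C ordA ordU ordE) μ) where
  open Construction C ordA ordU ordE
  open Matching μ

  assignment : ∀ i → ∃ λ j → M (inj₁ i) ≡ just (inj₁ j)
  assignment i with perfect (inj₁ i)
  ... | inj₁ j , a↦c = j , a↦c
  ... | inj₂ w , a↦w = ⊥-elim (M-acc _ (inj₂ w) a↦w)

  choice : Fin n → Fin m
  choice = proj₁ ∘ assignment

  chosen? : Decidable (λ j → ∃ λ i → choice i ≡ j)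
  chosen? j = any? (λ i → choice i ≟ j)

  chosenSets : Subset m
  chosenSets = subset chosen?

  chosenSets-cover : IsCover C chosenSets
  chosenSets-cover i = choice i , ∈subset⁺ chosen? (i , refl) , M-acc _ _ (proj₂ (assignment i))

  dummies-follow : ∀ {i j} → M (inj₁ i) ≡ just (inj₁ j) → ∀ l → M (inj₂ (j , l)) ≡ just (inj₁ j)
  dummies-follow {i} {j} a↦c l with perfect (inj₂ (j , l))
  ... | inj₁ _ , u↦c with refl ← M-acc _ _ u↦c = u↦c
  ... | inj₂ _ , u↦w =
    ⊥-elim (envy-free (inj₁ i) (inj₁ j) (inj₂ (j , l)) a↦c refl tt
             (subst (PrefersTo I' (inj₂ (j , l)) (inj₁ j)) (sym u↦w) tt))

  paid : CAgent n m → ℕ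
  paid a = maybe costP 0 (M a)

  dummyCost : Fin m → ℕ
  dummyCost j = sum (map (λ l → paid (inj₂ (j , l))) (allFin n))

  n≤dummyCost : ∀ {j} → j ∈ chosenSets → n ≤ dummyCost j
  n≤dummyCost {j} j∈ with i , refl ← ∈subset⁻ chosen? j∈ =
    subst (n ≤_) (sym (cong sum (map-tabulate id (λ l → paid (inj₂ (choice i , l))))))
          (n≤sum-tabulate _ dummy-pays)
    where
    dummy-pays : ∀ l → 1 ≤ paid (inj₂ (choice i , l))
    dummy-pays l rewrite dummies-follow (proj₂ (assignment i)) l = ≤-refl

  sum-dummyCost≤costOf : sum (tabulate dummyCost) ≤ costOf I' μ
  sum-dummyCost≤costOf = begin
    sum (tabulate dummyCost)                       ≡⟨ cong sum (map-tabulate id dummyCost) ⟨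
    sum (map dummyCost (allFin m))                 ≡⟨ sum-cartesianProduct (paid ∘ inj₂) (allFin m) (allFin n) ⟨
    sum (map (paid ∘ inj₂) dummies)                ≡⟨ cong sum (map-∘ dummies) ⟩
    sum (map paid (map inj₂ dummies))              ≤⟨ m≤n+m _ _ ⟩
    sum (map paid elements) + sum (map paid (map inj₂ dummies))
                                                   ≡⟨ sum-++ (map paid elements) _ ⟨
    sum (map paid elements ++ map paid (map inj₂ dummies))
                                                   ≡⟨ cong sum (map-++ paid elements _) ⟨
    costOf I' μ                                    ∎
    where
    open ≤-Reasoning
    elements = map inj₁ (allFin n)
    dummies = cartesianProductWith _,_ (allFin m) (allFin n)

  ∣chosenSets∣*n≤costOf : ∣ chosenSets ∣ * n ≤ costOf I' μ
  ∣chosenSets∣*n≤costOf = ≤-trans (∣p∣*b≤sum-tabulate chosenSets dummyCost n≤dummyCost) sum-dummyCost≤costOf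

  ∣chosenSets∣*q≤b : ∀ {b q} → costOf I' μ * q ≤ b * n → ∣ chosenSets ∣ * q ≤ b
  -- n may be 0, but only when no set is chosen.
  ∣chosenSets∣*q≤b {b} {q} cost≤ with nonempty? chosenSets
  ... | no empty rewrite Empty-unique empty | ∣⊥∣≡0 m = z≤n
  ... | yes (j , j∈) = *-cancelʳ-≤ _ b n {{nonZeroIndex (proj₁ (∈subset⁻ chosen? j∈))}} (begin
    ∣ chosenSets ∣ * q * n   ≡⟨ xy∙z≈xz∙y ∣ chosenSets ∣ q n ⟩
    ∣ chosenSets ∣ * n * q   ≤⟨ *-monoˡ-≤ q ∣chosenSets∣*n≤costOf ⟩
    costOf I' μ * q          ≤⟨ cost≤ ⟩
    b * n                    ∎)
    where open ≤-Reasoning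

mainTheorem5 : ∀ {n m : ℕ} (C : Fin m → Subset n) (k : ℕ) → 1 < k →
    (ordA : Fin n → Fin m → ℕ) (ordU ordE : Fin m → Fin n → ℕ) →
    (∀ i → Injective _≡_ _≡_ (ordA i)) →
    (∀ j → Injective _≡_ _≡_ (ordU j)) →
    (∀ j → Injective _≡_ _≡_ (ordE j)) →
    (μ : Matching (Construction.I' C ordA ordU ordE)) →
    APerfect (Construction.I' C ordA ordU ordE) μ →
    EnvyFree (Construction.I' C ordA ordU ordE) μ →
    (p q : ℕ) → 0 < q → q < p →
    costOf (Construction.I' C ordA ordU ordE) μ * q ≤ p * ((k + 1) * n) →
    Σ (Subset m) (λ T → IsCover C T × (∣ T ∣ * q ≤ 2 * p * k))
mainTheorem5 {n} C k 1<k ordA ordU ordE _ _ _ μ perfect envy-free p q _ _ cost≤ =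
  chosenSets , chosenSets-cover ,
  ≤-trans (∣chosenSets∣*q≤b (≤-trans cost≤ (≤-reflexive (sym (*-assoc p (k + 1) n)))))
          (p*[k+1]≤2*p*k p (<⇒≤ 1<k))
  where open CoverFromMatching C ordA ordU ordE μ perfect envy-free
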